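{- Let $G=(V,E)$ be a simple graph and let $I\subseteq V$ be an independent set such that $d(v)\ge 2$ for every $v\in I$. Then there exists an orientation $D$ of $G$ such that $\gamma_{os}(D)\le |V\setminus I|$.
   Context: An orientation of $G$ replaces each edge by exactly one of its two arcs; $G$ is then the underlying graph of $D$. In $G$, $S\subseteq V$ is dominating if every vertex outside $S$ has a neighbor in $S$. For a digraph $D$ with underlying graph $G$, $S$ is an out-secure dominating set (OSDS) of $D$ if $S$ is dominating in $G$ and for every $v\in V\setminus S$ there is an in-neighbor $u\in S$ of $v$ (arc $uv$ in $D$) such that $(S\setminus\{u\})\cup\{v\}$ is dominating in $G$; $\gamma_{os}(D)$ is the minimum size of an OSDS of $D$. -}

module Defs where

open import Data.Nat using (ℕ; _≤_)
open import Data.Bool using (Bool; true; false; T)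
open import Data.Fin using (Fin)
open import Data.Fin.Subset using (Subset; _∈_; _∉_; ∣_∣; ∁; _-_; ⁅_⁆; _∪_; _─_)
open import Data.Product using (Σ; ∃; _×_; _,_)
open import Data.Sum using (_⊎_)
open import Relation.Binary.PropositionalEquality using (_≡_)
open import Relation.Nullary using (¬_)
open import Data.List using (List; filter; length)
open import Data.List.Base using (allFin)
open import Relation.Nullary.Decidable using (does)
open import Data.Bool using (_≟_)

record SimpleGraph (n : ℕ) : Set where
  field
    adj    : Fin n → Fin n → Bool
    sym    : ∀ u v → adj u v ≡ adj v u
    irrefl : ∀ v → adj v v ≡ false
open SimpleGraph public

Adj : ∀ {n} → SimpleGraph n → Fin n → Fin n → Set
Adj G u v = T (adj G u v)

degree : ∀ {n} → SimpleGraph n → Fin n → ℕ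
degree {n} G v = length (filter (λ u → adj G v u ≟ true) (allFin n))

Independent : ∀ {n} → SimpleGraph n → Subset n → Set
Independent G I = ∀ u v → u ∈ I → v ∈ I → ¬ Adj G u v

-- A digraph on Fin n: arc u v means the arc u → v is present.
-- D is an orientation of G: every arc is an edge of G, and every edge {u,v}
-- is replaced by exactly one of the arcs uv, vu.
IsOrientation : ∀ {n} → SimpleGraph n → (Fin n → Fin n → Bool) → Set
IsOrientation G arc =
  (∀ u v → T (arc u v) → Adj G u v) ×
  (∀ u v → Adj G u v → (T (arc u v) × ¬ T (arc v u)) ⊎ (T (arc v u) × ¬ T (arc u v)))

Dominating : ∀ {n} → SimpleGraph n → Subset n → Set
Dominating G S = ∀ v → v ∉ S → ∃ λ u → u ∈ S × Adj G u v

OSDS : ∀ {n} → SimpleGraph n → (Fin n → Fin n → Bool) → Subset n → Set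
OSDS G arc S =
  Dominating G S ×
  (∀ v → v ∉ S → ∃ λ u → u ∈ S × T (arc u v) × Dominating G ((S ─ ⁅ u ⁆) ∪ ⁅ v ⁆))

-- γ_os(D) ≤ k  (γ_os(D) is the minimum size of an OSDS; V itself is always an OSDS,
-- so the minimum exists, and it is ≤ k iff some OSDS has size ≤ k)
γos≤ : ∀ {n} → SimpleGraph n → (Fin n → Fin n → Bool) → ℕ → Set
γos≤ G arc k = ∃ λ S → OSDS G arc S × ∣ S ∣ ≤ k

-- Put S = V ∖ I and orient every edge between S and I towards I. S dominates
-- because each vertex of I has a neighbour and all its neighbours lie in S. If
-- v ∈ I is guarded by a neighbour u ∈ S (so uv is an arc), then in (S ∖ {u}) ∪ {v}
-- the vertex u is dominated by v, and every other w ∈ I still has a neighbour in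
-- S ∖ {u}, since it has at least two neighbours.
module Submission where

open import Defs
open import Data.Nat using (ℕ; _≤_; _<_; _<ᵇ_; s≤s)
open import Data.Nat.Properties using (<ᵇ⇒<; <⇒<ᵇ; <-cmp; <-asym; ≤-refl)
open import Data.Bool using (Bool; true; T; _∧_; if_then_else_; _≟_)
open import Data.Bool.Properties using (T-∧; T-≡)
open import Data.Fin using (Fin; zero; suc; toℕ; combine)
open import Data.Fin.Properties using (toℕ-injective; combine-injectiveʳ; combine-monoˡ-<)
open import Data.Fin.Subset using (Subset; _∈_; _∉_; ∣_∣; ∁; _─_; ⁅_⁆; _∪_; inside; outside)
open import Data.Fin.Subset.Properties
  using (_∈?_; x∈∁p⇒x∉p; x∉∁p⇒x∈p; x∉p⇒x∈∁p; x∈p∪q⁺; x∈⁅y⁆⇒x≡y; x∈⁅x⁆)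
open import Data.Product using (Σ; ∃; _×_; _,_; proj₁; proj₂)
open import Data.Sum using (_⊎_; inj₁; inj₂)
open import Data.Vec using (_∷_; here; there)
open import Data.List using (List; []; _∷_; length; allFin)
open import Data.List.Relation.Unary.Any using (here; there)
open import Data.List.Relation.Unary.All using (_∷_)
open import Data.List.Relation.Unary.AllPairs using (_∷_)
open import Data.List.Relation.Unary.Unique.Propositional using (Unique)
open import Data.List.Relation.Unary.Unique.Propositional.Properties using (allFin⁺; filter⁺)
open import Data.List.Membership.Propositional using () renaming (_∈_ to _∈ₗ_)
open import Data.List.Membership.Propositional.Properties using (∈-filter⁻)
open import Relation.Nullary using (¬_; Dec; yes; no; does; contradiction)
open import Relation.Binary using (tri<; tri≈; tri>)
open import Relation.Binary.Definitions using (DecidableEquality)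
open import Relation.Binary.PropositionalEquality using (_≡_; _≢_; refl; subst) renaming (sym to ≡-sym)
open import Function using (Injective; _∘_; Equivalence)
import Data.Fin as Fin

x∈p─q⁺ : ∀ {n} {x : Fin n} {p q : Subset n} → x ∈ p → x ∉ q → x ∈ p ─ q
x∈p─q⁺ {x = zero}  {inside ∷ p} {outside ∷ q} here      x∉q = here
x∈p─q⁺ {x = zero}  {inside ∷ p} {inside ∷ q}  here      x∉q = contradiction here x∉q
x∈p─q⁺ {x = suc x} {_ ∷ p}      {_ ∷ q}       (there x∈p) x∉q = there (x∈p─q⁺ x∈p (x∉q ∘ there))

x∈p-y⁺ : ∀ {n} {x y : Fin n} {p : Subset n} → x ∈ p → x ≢ y → x ∈ p ─ ⁅ y ⁆
x∈p-y⁺ {y = y} x∈p x≢y = x∈p─q⁺ x∈p (x≢y ∘ x∈⁅y⁆⇒x≡y y)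

∃-≢-∈-unique : ∀ {A : Set} → DecidableEquality A → (u : A) {xs : List A} →
               Unique xs → 2 ≤ length xs → ∃ λ w → w ∈ₗ xs × w ≢ u
∃-≢-∈-unique _ u {_ ∷ []} _ (s≤s ())
∃-≢-∈-unique _≟ₐ_ u {a ∷ b ∷ _} ((a≢b ∷ _) ∷ _) _ with a ≟ₐ u
... | yes refl = b , there (here refl) , a≢b ∘ ≡-sym
... | no a≢u   = a , here refl , a≢u

Adj-sym : ∀ {n} (G : SimpleGraph n) {u v} → Adj G u v → Adj G v u
Adj-sym G {u} {v} = subst T (SimpleGraph.sym G u v)

Adj-irrefl : ∀ {n} (G : SimpleGraph n) {v} → ¬ Adj G v v
Adj-irrefl G {v} = subst T (irrefl G v)

∃-neighbour-≢ : ∀ {n} (G : SimpleGraph n) {v} (u : Fin n) → 2 ≤ degree G v →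
                ∃ λ w → Adj G v w × w ≢ u
∃-neighbour-≢ {n} G {v} u 2≤deg =
  let w , w∈ , w≢u = ∃-≢-∈-unique Fin._≟_ u (filter⁺ isNeighbour (allFin⁺ n)) 2≤deg
  in w , Equivalence.from T-≡ (proj₂ (∈-filter⁻ isNeighbour {xs = allFin n} w∈)) , w≢u
  where
  isNeighbour : (w : Fin n) → Dec (adj G v w ≡ true)
  isNeighbour w = adj G v w ≟ true

rankOrientation : ∀ {n} → SimpleGraph n → (Fin n → ℕ) → Fin n → Fin n → Bool
rankOrientation G r u v = adj G u v ∧ (r u <ᵇ r v)

module _ {n} (G : SimpleGraph n) (r : Fin n → ℕ) where

  rankOrientation⁺ : ∀ {u v} → Adj G u v → r u < r v → T (rankOrientation G r u v)
  rankOrientation⁺ uv ru<rv = Equivalence.from T-∧ (uv , <⇒<ᵇ ru<rv)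

  rankOrientation⁻ : ∀ {u v} → T (rankOrientation G r u v) → Adj G u v × r u < r v
  rankOrientation⁻ arc with uv , lt ← Equivalence.to T-∧ arc = uv , <ᵇ⇒< _ _ lt

  rankOrientation-isOrientation : Injective _≡_ _≡_ r → IsOrientation G (rankOrientation G r)
  rankOrientation-isOrientation r-inj = (λ _ _ → proj₁ ∘ rankOrientation⁻) , oneWay
    where
    oneWay : ∀ u v → Adj G u v →
             (T (rankOrientation G r u v) × ¬ T (rankOrientation G r v u)) ⊎
             (T (rankOrientation G r v u) × ¬ T (rankOrientation G r u v))
    oneWay u v uv with <-cmp (r u) (r v)
    ... | tri< lt _ _ = inj₁ (rankOrientation⁺ uv lt , <-asym lt ∘ proj₂ ∘ rankOrientation⁻)
    ... | tri> _ _ gt = inj₂ (rankOrientation⁺ (Adj-sym G uv) gt , <-asym gt ∘ proj₂ ∘ rankOrientation⁻)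
    ... | tri≈ _ eq _ with refl ← r-inj eq = contradiction uv (Adj-irrefl G)

module _ {n} (I : Subset n) where

  side : Fin n → Fin 2
  side u = if does (u ∈? I) then suc zero else zero

  outsideFirst : Fin n → ℕ
  outsideFirst u = toℕ (combine (side u) u)

  outsideFirst-injective : Injective _≡_ _≡_ outsideFirst
  outsideFirst-injective {u} {v} eq = combine-injectiveʳ (side u) u (side v) v (toℕ-injective eq)

  outsideFirst-∉-∈ : ∀ {u v} → u ∉ I → v ∈ I → outsideFirst u < outsideFirst v
  outsideFirst-∉-∈ {u} {v} u∉I v∈I with u ∈? I | v ∈? I
  ... | yes u∈I | _       = contradiction u∈I u∉I
  ... | _       | no v∉I  = contradiction v∈I v∉I
  ... | no _    | yes _   = combine-monoˡ-< {i = zero} {j = suc {1} zero} u v (s≤s ≤-refl)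

module _ {n} (G : SimpleGraph n) {I : Subset n} (independent : Independent G I) where

  neighbour-∈∁ : ∀ {w x} → w ∈ I → Adj G w x → x ∈ ∁ I
  neighbour-∈∁ {w} {x} w∈I wx = x∉p⇒x∈∁p λ x∈I → independent w x w∈I x∈I wx

  ∁-dominating : (∀ v → v ∈ I → ∃ (Adj G v)) → Dominating G (∁ I)
  ∁-dominating hasNeighbour w w∉∁I
    with x , wx ← hasNeighbour w (x∉∁p⇒x∈p w∉∁I)
    = x , neighbour-∈∁ (x∉∁p⇒x∈p w∉∁I) wx , Adj-sym G wx

  ∁-swap-dominating : (∀ v → v ∈ I → 2 ≤ degree G v) → ∀ {u v} → Adj G u v →
                      Dominating G ((∁ I ─ ⁅ u ⁆) ∪ ⁅ v ⁆)
  ∁-swap-dominating 2≤deg {u} {v} uv w w∉T with w ∈? I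
  ... | yes w∈I
      with x , wx , x≢u ← ∃-neighbour-≢ G u (2≤deg w w∈I)
      = x , x∈p∪q⁺ (inj₁ (x∈p-y⁺ (neighbour-∈∁ w∈I wx) x≢u)) , Adj-sym G wx
  ... | no w∉I with w Fin.≟ u
  ...   | yes refl = v , x∈p∪q⁺ (inj₂ (x∈⁅x⁆ v)) , Adj-sym G uv
  ...   | no w≢u   = contradiction (x∈p∪q⁺ (inj₁ (x∈p-y⁺ (x∉p⇒x∈∁p w∉I) w≢u))) w∉T

proposition3p6 : ∀ (n : ℕ) (G : SimpleGraph n) (I : Subset n) →
    Independent G I → (∀ v → v ∈ I → 2 ≤ degree G v) →
    Σ (Fin n → Fin n → Bool) (λ arc → IsOrientation G arc × γos≤ G arc ∣ ∁ I ∣)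
proposition3p6 n G I independent 2≤deg =
  arc , rankOrientation-isOrientation G r (outsideFirst-injective I) ,
  ∁ I , (∁-dominating G independent hasNeighbour , secure) , ≤-refl
  where
  r : Fin n → ℕ
  r = outsideFirst I

  arc : Fin n → Fin n → Bool
  arc = rankOrientation G r

  hasNeighbour : ∀ v → v ∈ I → ∃ (Adj G v)
  hasNeighbour v v∈I with w , vw , _ ← ∃-neighbour-≢ G v (2≤deg v v∈I) = w , vw

  secure : ∀ v → v ∉ ∁ I → ∃ λ u → u ∈ ∁ I × T (arc u v) × Dominating G ((∁ I ─ ⁅ u ⁆) ∪ ⁅ v ⁆)
  secure v v∉∁I = u , u∈∁I , rankOrientation⁺ G r uv (outsideFirst-∉-∈ I (x∈∁p⇒x∉p u∈∁I) v∈I) ,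
                  ∁-swap-dominating G independent 2≤deg uv
    where
    v∈I : v ∈ I
    v∈I = x∉∁p⇒x∈p v∉∁I

    u : Fin n
    u = proj₁ (hasNeighbour v v∈I)

    uv : Adj G u v
    uv = Adj-sym G (proj₂ (hasNeighbour v v∈I))

    u∈∁I : u ∈ ∁ I
    u∈∁I = neighbour-∈∁ G independent v∈I (Adj-sym G uv)
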